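{- For every integer $n\ge 1$, $noc(P_n)\le noc(K_{1,n-1})=2^{n-1}+n$, and equality holds if and only if $n\le 5$.
   Context: For a finite simple undirected graph $G=(V,E)$, a set $S\subseteq V$ is called $P_3$-convex if for every path $x$--$z$--$y$ in $G$ (distinct vertices $x,z,y$ with $xz,zy\in E$) with $x,y\in S$, we also have $z\in S$. The number $noc(G)$ denotes the number of $P_3$-convex subsets of $V$ (including $\emptyset$). $P_n$ is the path graph on $n$ vertices and $K_{1,n-1}$ is the star on $n$ vertices. -}

module Defs where

open import Data.Bool using (Bool; true; false; T; T?)
open import Data.Nat using (ℕ; zero; suc; _+_; _≟_)
open import Data.Fin using (Fin; toℕ)
import Data.Fin as Fin
open import Data.Fin.Properties using (all?)
open import Data.Vec using (Vec; []; _∷_; lookup)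
open import Data.List using (List; []; _∷_; _++_; map; filter; length)
open import Data.Sum using (_⊎_)
open import Relation.Nullary using (Dec; ¬_; ¬?)
open import Relation.Nullary.Decidable using (_→-dec_; _⊎-dec_; _×-dec_)
open import Relation.Binary.PropositionalEquality using (_≡_)

record Graph (n : ℕ) : Set₁ where
  field
    Adj   : Fin n → Fin n → Set
    adj?  : (x y : Fin n) → Dec (Adj x y)
    sym   : ∀ {x y} → Adj x y → Adj y x
    irrefl : ∀ {x} → ¬ Adj x x
open Graph public

Subset : ℕ → Set
Subset n = Vec Bool n

_∈_ : ∀ {n} → Fin n → Subset n → Set
x ∈ S = T (lookup S x)

P3-convex : ∀ {n} → Graph n → Subset n → Set
P3-convex {n} G S =
  (x z y : Fin n) → ¬ x ≡ z → ¬ z ≡ y → ¬ x ≡ y →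
  Adj G x z → Adj G z y → x ∈ S → y ∈ S → z ∈ S

P3-convex? : ∀ {n} (G : Graph n) (S : Subset n) → Dec (P3-convex G S)
P3-convex? G S =
  all? λ x → all? λ z → all? λ y →
    ¬? (x Fin.≟ z) →-dec ¬? (z Fin.≟ y) →-dec ¬? (x Fin.≟ y) →-dec
    adj? G x z →-dec adj? G z y →-dec T? (lookup S x) →-dec T? (lookup S y) →-dec
    T? (lookup S z)

allSubsets : (n : ℕ) → List (Subset n)
allSubsets zero = [] ∷ []
allSubsets (suc n) = map (true ∷_) (allSubsets n) ++ map (false ∷_) (allSubsets n)

noc : ∀ {n} → Graph n → ℕ
noc {n} G = length (filter (P3-convex? G) (allSubsets n))

PathAdj : ∀ {n} → Fin n → Fin n → Set
PathAdj i j = (suc (toℕ i) ≡ toℕ j) ⊎ (suc (toℕ j) ≡ toℕ i)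

pathGraph : (n : ℕ) → Graph n
pathGraph n = record
  { Adj = PathAdj
  ; adj? = λ i j → (suc (toℕ i) ≟ toℕ j) ⊎-dec (suc (toℕ j) ≟ toℕ i)
  ; sym = λ { (Data.Sum.inj₁ p) → Data.Sum.inj₂ p ; (Data.Sum.inj₂ p) → Data.Sum.inj₁ p }
  ; irrefl = λ { (Data.Sum.inj₁ p) → n≢1+n p ; (Data.Sum.inj₂ p) → n≢1+n p }
  }
  where
  open import Data.Nat.Properties using () renaming (1+n≢n to n≢1+n)

StarAdj : ∀ {n} → Fin n → Fin n → Set
StarAdj i j = (toℕ i ≡ 0 × ¬ toℕ j ≡ 0) ⊎ (toℕ j ≡ 0 × ¬ toℕ i ≡ 0)
  where open import Data.Product using (_×_)

starGraph : (n : ℕ) → Graph n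
starGraph n = record
  { Adj = StarAdj
  ; adj? = λ i j → ((toℕ i ≟ 0) ×-dec ¬? (toℕ j ≟ 0)) ⊎-dec ((toℕ j ≟ 0) ×-dec ¬? (toℕ i ≟ 0))
  ; sym = λ { (Data.Sum.inj₁ p) → Data.Sum.inj₂ p ; (Data.Sum.inj₂ p) → Data.Sum.inj₁ p }
  ; irrefl = λ { (Data.Sum.inj₁ (p , q)) → q p ; (Data.Sum.inj₂ (p , q)) → q p }
  }
  where open import Data.Product using (_,_)

{-# OPTIONS --safe #-}
-- In P_n the P₃-paths are the triples i, i+1, i+2 (in either direction), so the
-- convex sets are the binary words without a factor 101.  Splitting off the first
-- letter, the numbers a, b, c of words w of length n such that w, 1w and 10w avoid
-- 101 satisfy a′ = b + a, b′ = b + c, c′ = a; from n = 7 on this keeps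
-- a ≤ 4j + 1, b ≤ 3j + 1, c ≤ 3j for j = 2^(n-3), so a(n) ≤ 2^(n-1) + 1.
-- In K_{1,n-1} every P₃-path has the centre in the middle, so a set is convex iff
-- it contains the centre or at most one leaf: 2^(n-1) + n sets.  The first values
-- a(1..6) = 2, 4, 7, 12, 21, 37 against 2, 4, 7, 12, 21, 38 settle n ≤ 6.
module Submission where

open import Defs
open import Data.Nat using (ℕ; _+_; _∸_; _^_; _≤_)
open import Data.Product using (_×_)
open import Function.Bundles using (_⇔_)
open import Relation.Binary.PropositionalEquality using (_≡_)

open import Data.Bool using (Bool; true; false; T; T?; not; _∧_)
open import Data.Bool.Properties using (T-∧)
open import Data.Empty using (⊥-elim)
open import Data.Fin as Fin using (Fin; zero; suc; toℕ)
open import Data.Fin.Properties using (toℕ-injective; 0≢1+n; suc-injective)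
open import Data.List using (List; []; _∷_; _++_; map; filter; length)
open import Data.List.Properties using (length-++; length-map; filter-++; filter-≐; filter-all; filter-none)
open import Data.List.Relation.Unary.All using (universal)
open import Data.Nat using (zero; suc; _*_; _<_; _≤?_; z≤n; s≤s)
open import Data.Nat.Properties
  using ( ≤-refl; ≤-reflexive; ≤-trans; <⇒≤; <⇒≢; ≰⇒>; +-mono-≤; +-monoʳ-<; m+n≤o⇒m≤o
        ; +-identityʳ; m^n>0; m≤n⇒∃[o]m+o≡n; ^-distribˡ-+-*; module ≤-Reasoning)
import Data.Nat.Properties as ℕ
open import Data.Nat.Tactic.RingSolver using (solve-∀)
open import Data.Product using (_,_; proj₁)
open import Data.Product.Function.NonDependent.Propositional using (_×-⇔_)
open import Data.Sum using (inj₁; inj₂)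
import Data.Sum as Sum
open import Data.Vec using ([]; _∷_; lookup)
open import Function using (_∘_; const)
open import Function.Bundles using (mk⇔; module Equivalence)
open import Function.Construct.Composition using (_⇔-∘_)
open import Function.Construct.Symmetry using (⇔-sym)
open import Relation.Binary.PropositionalEquality
  using (refl; cong; cong₂; subst; module ≡-Reasoning) renaming (sym to ≡-sym; trans to ≡-trans)
open import Relation.Nullary using (¬_; does; yes; no; contradiction)
open import Relation.Nullary.Decidable using (decidable-stable; toWitness)
open import Relation.Unary using (Pred; Decidable)

count : ∀ {n ℓ} {P : Pred (Subset n) ℓ} → Decidable P → ℕ
count {n} P? = length (filter P? (allSubsets n))

length-allSubsets : ∀ n → length (allSubsets n) ≡ 2 ^ n
length-allSubsets zero = refl
length-allSubsets (suc n) = begin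
  length (map (true ∷_) Ss ++ map (false ∷_) Ss)          ≡⟨ length-++ (map (true ∷_) Ss) ⟩
  length (map (true ∷_) Ss) + length (map (false ∷_) Ss)  ≡⟨ cong₂ _+_ (length-map _ Ss) (length-map _ Ss) ⟩
  length Ss + length Ss                                    ≡⟨ cong (λ k → k + k) (length-allSubsets n) ⟩
  2 ^ n + 2 ^ n                                            ≡⟨ cong (2 ^ n +_) (≡-sym (+-identityʳ (2 ^ n))) ⟩
  2 ^ suc n                                                ∎
  where
  open ≡-Reasoning
  Ss : List (Subset n)
  Ss = allSubsets n

filter-map : ∀ {a b ℓ} {A : Set a} {B : Set b} {P : Pred B ℓ} (P? : Decidable P) (f : A → B) xs →
             filter P? (map f xs) ≡ map f (filter (λ x → P? (f x)) xs)
filter-map P? f [] = refl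
filter-map P? f (x ∷ xs) with does (P? (f x))
... | true  = cong (f x ∷_) (filter-map P? f xs)
... | false = filter-map P? f xs

count-∷ : ∀ {n ℓ} {P : Pred (Subset (suc n)) ℓ} (P? : Decidable P) →
          count P? ≡ count (λ S → P? (true ∷ S)) + count (λ S → P? (false ∷ S))
count-∷ {n} P? = begin
  length (filter P? (map (true ∷_) Ss ++ map (false ∷_) Ss))
    ≡⟨ cong length (filter-++ P? (map (true ∷_) Ss) _) ⟩
  length (filter P? (map (true ∷_) Ss) ++ filter P? (map (false ∷_) Ss))
    ≡⟨ length-++ (filter P? (map (true ∷_) Ss)) ⟩
  length (filter P? (map (true ∷_) Ss)) + length (filter P? (map (false ∷_) Ss))
    ≡⟨ cong₂ _+_ (length-filter-map (true ∷_)) (length-filter-map (false ∷_)) ⟩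
  count (λ S → P? (true ∷ S)) + count (λ S → P? (false ∷ S))
    ∎
  where
  open ≡-Reasoning
  Ss : List (Subset n)
  Ss = allSubsets n
  length-filter-map : ∀ f → length (filter P? (map f Ss)) ≡ length (filter (λ S → P? (f S)) Ss)
  length-filter-map f = ≡-trans (cong length (filter-map P? f Ss)) (length-map f (filter (λ S → P? (f S)) Ss))

count-⇔ : ∀ {n ℓ₁ ℓ₂} {P : Pred (Subset n) ℓ₁} {Q : Pred (Subset n) ℓ₂}
          (P? : Decidable P) (Q? : Decidable Q) → (∀ S → P S ⇔ Q S) → count P? ≡ count Q?
count-⇔ {n} P? Q? P⇔Q =
  cong length (filter-≐ P? Q? ((λ {S} → to (P⇔Q S)) , (λ {S} → from (P⇔Q S))) (allSubsets n))
  where open Equivalence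

count-all : ∀ {n ℓ} {P : Pred (Subset n) ℓ} (P? : Decidable P) → (∀ S → P S) → count P? ≡ 2 ^ n
count-all {n} P? all =
  ≡-trans (cong length (filter-all P? (universal all (allSubsets n)))) (length-allSubsets n)

count-none : ∀ {n ℓ} {P : Pred (Subset n) ℓ} (P? : Decidable P) → (∀ S → ¬ P S) → count P? ≡ 0
count-none {n} P? none = cong length (filter-none P? (universal none (allSubsets n)))

-- Reading bits at natural-number positions, with false out of range, lets
-- Gapless talk about i, i+1, i+2 without any bound on i.
_‼_ : ∀ {n} → Subset n → ℕ → Bool
[]      ‼ _     = false
(b ∷ S) ‼ zero  = b
(b ∷ S) ‼ suc i = S ‼ i

‼-toℕ : ∀ {n} (S : Subset n) (x : Fin n) → S ‼ toℕ x ≡ lookup S x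
‼-toℕ (b ∷ S) zero    = refl
‼-toℕ (b ∷ S) (suc x) = ‼-toℕ S x

Gapless : ∀ {n} → Subset n → Set
Gapless S = ∀ i → T (S ‼ i) → T (S ‼ (2 + i)) → T (S ‼ (1 + i))

gaplessᵇ : ∀ {n} → Subset n → Bool
gaplessᵇ []      = true
gaplessᵇ (a ∷ S) = not (a ∧ not (S ‼ 0) ∧ S ‼ 1) ∧ gaplessᵇ S

T-not-gap : ∀ a b c → T (not (a ∧ not b ∧ c)) ⇔ (T a → T c → T b)
T-not-gap false b     c     = mk⇔ (λ _ ()) (const _)
T-not-gap true  true  c     = mk⇔ (λ _ _ _ → _) (const _)
T-not-gap true  false true  = mk⇔ (λ ()) (λ gap → gap _ _)
T-not-gap true  false false = mk⇔ (λ _ _ ()) (const _)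

gapless-∷ : ∀ {n a} {S : Subset n} → Gapless (a ∷ S) ⇔ ((T a → T (S ‼ 1) → T (S ‼ 0)) × Gapless S)
gapless-∷ = mk⇔ (λ g → g 0 , λ i → g (suc i)) λ { (h , g) zero → h ; (h , g) (suc i) → g i }

T-gaplessᵇ : ∀ {n} (S : Subset n) → T (gaplessᵇ S) ⇔ Gapless S
T-gaplessᵇ []      = mk⇔ (λ _ _ ()) (const _)
T-gaplessᵇ (a ∷ S) = ⇔-sym gapless-∷ ⇔-∘ ((T-not-gap a (S ‼ 0) (S ‼ 1) ×-⇔ T-gaplessᵇ S) ⇔-∘ T-∧)

path-convex-tail : ∀ {n b} {S : Subset n} → P3-convex (pathGraph (suc n)) (b ∷ S) → P3-convex (pathGraph n) S
path-convex-tail convex x z y x≢z z≢y x≢y x~z z~y =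
  convex (suc x) (suc z) (suc y) (x≢z ∘ suc-injective) (z≢y ∘ suc-injective) (x≢y ∘ suc-injective)
    (shift x~z) (shift z~y)
  where
  shift : ∀ {n} {u v : Fin n} → PathAdj u v → PathAdj (suc u) (suc v)
  shift = Sum.map (cong suc) (cong suc)

path-convex⇒gapless : ∀ {n} (S : Subset n) → P3-convex (pathGraph n) S → Gapless S
path-convex⇒gapless (a ∷ b ∷ c ∷ S) convex zero =
  convex zero (suc zero) (suc (suc zero)) (λ ()) (λ ()) (λ ()) (inj₁ refl) (inj₁ refl)
path-convex⇒gapless (a ∷ S) convex (suc i) = path-convex⇒gapless S (path-convex-tail convex) i
path-convex⇒gapless (a ∷ [])     _ zero _ ()
path-convex⇒gapless (a ∷ b ∷ []) _ zero _ ()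

gapless-step : ∀ {n} {S : Subset n} {x z y : Fin n} → Gapless S →
               suc (toℕ x) ≡ toℕ z → suc (toℕ z) ≡ toℕ y → x ∈ S → y ∈ S → z ∈ S
gapless-step {S = S} {x} {z} {y} gapless x→z z→y x∈ y∈ =
  subst T (‼-toℕ S z) (subst (T ∘ (S ‼_)) x→z (gapless (toℕ x) (∈⇒‼ x x∈) 2+x∈))
  where
  ∈⇒‼ : ∀ v → v ∈ S → T (S ‼ toℕ v)
  ∈⇒‼ v = subst T (≡-sym (‼-toℕ S v))
  2+x∈ : T (S ‼ (2 + toℕ x))
  2+x∈ = subst (T ∘ (S ‼_)) (≡-sym (≡-trans (cong suc x→z) z→y)) (∈⇒‼ y y∈)

gapless⇒path-convex : ∀ {n} (S : Subset n) → Gapless S → P3-convex (pathGraph n) S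
gapless⇒path-convex S gapless x z y _ _ _   (inj₁ x→z) (inj₁ z→y) x∈ y∈ =
  gapless-step {S = S} gapless x→z z→y x∈ y∈
gapless⇒path-convex S gapless x z y _ _ _   (inj₂ z→x) (inj₂ y→z) x∈ y∈ =
  gapless-step {S = S} gapless y→z z→x y∈ x∈
gapless⇒path-convex S gapless x z y _ _ x≢y (inj₁ x→z) (inj₂ y→z) _  _  =
  ⊥-elim (x≢y (toℕ-injective (ℕ.suc-injective (≡-trans x→z (≡-sym y→z)))))
gapless⇒path-convex S gapless x z y _ _ x≢y (inj₂ z→x) (inj₁ z→y) _  _  =
  ⊥-elim (x≢y (toℕ-injective (≡-trans (≡-sym z→x) z→y)))

path-convex⇔gapless : ∀ {n} (S : Subset n) → P3-convex (pathGraph n) S ⇔ Gapless S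
path-convex⇔gapless S = mk⇔ (path-convex⇒gapless S) (gapless⇒path-convex S)

#gapFree #gapFreeAfter1 #gapFreeAfter10 : ℕ → ℕ
#gapFree        n = count {n} λ S → T? (gaplessᵇ S)
#gapFreeAfter1  n = count {n} λ S → T? (gaplessᵇ (true ∷ S))
#gapFreeAfter10 n = count {n} λ S → T? (gaplessᵇ (true ∷ false ∷ S))

noc-path : ∀ n → noc (pathGraph n) ≡ #gapFree n
noc-path n = count-⇔ (P3-convex? (pathGraph n)) (λ S → T? (gaplessᵇ S)) λ S →
  ⇔-sym (T-gaplessᵇ S) ⇔-∘ path-convex⇔gapless S

gapFreeCounts : ℕ → ℕ × ℕ × ℕ
gapFreeCounts n = #gapFree n , #gapFreeAfter1 n , #gapFreeAfter10 n

transfer : ℕ × ℕ × ℕ → ℕ × ℕ × ℕ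
transfer (a , b , c) = b + a , b + c , a

gapFreeCounts-suc : ∀ n → gapFreeCounts (suc n) ≡ transfer (gapFreeCounts n)
gapFreeCounts-suc n =
  cong₂ _,_ (count-∷ {n} λ S → T? (gaplessᵇ S))
            (cong₂ _,_ (count-∷ {n} λ S → T? (gaplessᵇ (true ∷ S))) after10-suc)
  where
  after10-suc : #gapFreeAfter10 (suc n) ≡ #gapFree n
  after10-suc = ≡-trans (count-∷ {n} λ S → T? (gaplessᵇ (true ∷ false ∷ S)))
                        (cong (_+ #gapFree n) (count-none {n} (λ S → T? false) λ _ ()))

Bounds : ℕ → ℕ × ℕ × ℕ → Set
Bounds j (a , b , c) = a ≤ 4 * j + 1 × b ≤ 3 * j + 1 × c ≤ 3 * j

bounds-transfer : ∀ {j t} → 1 ≤ j → Bounds j t → Bounds (2 * j) (transfer t)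
bounds-transfer {suc i} {a , b , c} _ (a≤ , b≤ , c≤) =
  ≤-trans (+-mono-≤ b≤ a≤) (m+n≤o⇒m≤o _ (≤-reflexive (first i))) ,
  ≤-trans (+-mono-≤ b≤ c≤) (≤-reflexive (second i)) ,
  ≤-trans a≤ (m+n≤o⇒m≤o _ (≤-reflexive (third i)))
  where
  first : ∀ i → (3 * suc i + 1) + (4 * suc i + 1) + i ≡ 4 * (2 * suc i) + 1
  first = solve-∀
  second : ∀ i → (3 * suc i + 1) + 3 * suc i ≡ 3 * (2 * suc i) + 1
  second = solve-∀
  third : ∀ i → (4 * suc i + 1) + (2 * i + 1) ≡ 3 * (2 * suc i)
  third = solve-∀

gapFreeCounts-bounds : ∀ m → Bounds (2 ^ (4 + m)) (gapFreeCounts (7 + m))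
gapFreeCounts-bounds zero    = ≤-refl , ≤-refl , toWitness {a? = 37 ≤? 48} _
gapFreeCounts-bounds (suc m) =
  subst (Bounds (2 ^ (5 + m))) (≡-sym (gapFreeCounts-suc (7 + m)))
    (bounds-transfer (m^n>0 2 (4 + m)) (gapFreeCounts-bounds m))

#gapFree-small : ∀ n → 1 ≤ n → n ≤ 5 → #gapFree n ≡ 2 ^ (n ∸ 1) + n
#gapFree-small 1 _ _ = refl
#gapFree-small 2 _ _ = refl
#gapFree-small 3 _ _ = refl
#gapFree-small 4 _ _ = refl
#gapFree-small 5 _ _ = refl
#gapFree-small (suc (suc (suc (suc (suc (suc _)))))) _ (s≤s (s≤s (s≤s (s≤s (s≤s ())))))

#gapFree-large : ∀ n → 6 ≤ n → #gapFree n < 2 ^ (n ∸ 1) + n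
#gapFree-large _ 6≤n with m≤n⇒∃[o]m+o≡n 6≤n
... | zero  , refl = ≤-refl
... | suc m , refl = begin-strict
  #gapFree (7 + m)       ≤⟨ proj₁ (gapFreeCounts-bounds m) ⟩
  4 * 2 ^ (4 + m) + 1    ≡⟨ cong (_+ 1) (≡-sym (^-distribˡ-+-* 2 2 (4 + m))) ⟩
  2 ^ (6 + m) + 1        <⟨ +-monoʳ-< (2 ^ (6 + m)) (s≤s (s≤s z≤n)) ⟩
  2 ^ (6 + m) + (7 + m)  ∎
  where open ≤-Reasoning

isEmptyᵇ : ∀ {n} → Subset n → Bool
isEmptyᵇ []      = true
isEmptyᵇ (b ∷ S) = not b ∧ isEmptyᵇ S

atMostOneᵇ : ∀ {n} → Subset n → Bool
atMostOneᵇ []         = true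
atMostOneᵇ (true ∷ S)  = isEmptyᵇ S
atMostOneᵇ (false ∷ S) = atMostOneᵇ S

AtMostOne : ∀ {n} → Subset n → Set
AtMostOne S = ∀ {i j} → i ∈ S → j ∈ S → i ≡ j

isEmptyᵇ-sound : ∀ {n} (S : Subset n) {i} → T (isEmptyᵇ S) → ¬ i ∈ S
isEmptyᵇ-sound (true  ∷ S) ()
isEmptyᵇ-sound (false ∷ S) {zero}  _     ()
isEmptyᵇ-sound (false ∷ S) {suc i} empty = isEmptyᵇ-sound S empty

isEmptyᵇ-complete : ∀ {n} (S : Subset n) → (∀ i → ¬ i ∈ S) → T (isEmptyᵇ S)
isEmptyᵇ-complete []          _     = _
isEmptyᵇ-complete (true  ∷ S) empty = empty zero _
isEmptyᵇ-complete (false ∷ S) empty = isEmptyᵇ-complete S (λ i → empty (suc i))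

T-atMostOneᵇ : ∀ {n} (S : Subset n) → T (atMostOneᵇ S) ⇔ AtMostOne S
T-atMostOneᵇ S = mk⇔ (sound S) (complete S)
  where
  sound : ∀ {n} (S : Subset n) → T (atMostOneᵇ S) → AtMostOne S
  sound (true  ∷ S) _     {zero}  {zero}  _  _  = refl
  sound (true  ∷ S) empty {zero}  {suc j} _  j∈ = ⊥-elim (isEmptyᵇ-sound S empty j∈)
  sound (true  ∷ S) empty {suc i}         i∈ _  = ⊥-elim (isEmptyᵇ-sound S empty i∈)
  sound (false ∷ S) one   {suc i} {suc j} i∈ j∈ = cong suc (sound S one i∈ j∈)
  complete : ∀ {n} (S : Subset n) → AtMostOne S → T (atMostOneᵇ S)
  complete []          _   = _
  complete (true  ∷ S) one = isEmptyᵇ-complete S λ i i∈ → 0≢1+n (one {zero} {suc i} _ i∈)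
  complete (false ∷ S) one = complete S λ i∈ j∈ → suc-injective (one i∈ j∈)

star-centre : ∀ {n} {x z y : Fin (suc n)} → StarAdj x z → StarAdj z y → ¬ x ≡ y → z ≡ zero
star-centre (inj₂ (z≡0 , _)) _                _   = toℕ-injective z≡0
star-centre (inj₁ _)         (inj₁ (z≡0 , _)) _   = toℕ-injective z≡0
star-centre (inj₁ (x≡0 , _)) (inj₂ (y≡0 , _)) x≢y = ⊥-elim (x≢y (toℕ-injective (≡-trans x≡0 (≡-sym y≡0))))

star-convex-∋centre : ∀ {n} (S : Subset (suc n)) → zero ∈ S → P3-convex (starGraph (suc n)) S
star-convex-∋centre S 0∈ x z y _ _ x≢y x~z z~y _ _ = subst (_∈ S) (≡-sym (star-centre x~z z~y x≢y)) 0∈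

star-convex⇔atMostOne : ∀ {n} (S : Subset n) → P3-convex (starGraph (suc n)) (false ∷ S) ⇔ AtMostOne S
star-convex⇔atMostOne S = mk⇔ convex⇒atMostOne atMostOne⇒convex
  where
  convex⇒atMostOne : P3-convex (starGraph _) (false ∷ S) → AtMostOne S
  convex⇒atMostOne convex {i} {j} i∈ j∈ = decidable-stable (i Fin.≟ j) λ i≢j →
    convex (suc i) zero (suc j) (λ ()) (λ ()) (i≢j ∘ suc-injective)
      (inj₂ (refl , λ ())) (inj₁ (refl , λ ())) i∈ j∈
  atMostOne⇒convex : AtMostOne S → P3-convex (starGraph _) (false ∷ S)
  atMostOne⇒convex _   zero    _       _       _ _ _   _   _   () _
  atMostOne⇒convex _   _       _       zero    _ _ _   _   _   _  ()
  atMostOne⇒convex one (suc i) zero    (suc j) _ _ x≢y _   _   i∈ j∈ = ⊥-elim (x≢y (cong suc (one i∈ j∈)))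
  atMostOne⇒convex _   (suc i) (suc k) (suc j) _ _ x≢y x~z z~y _  _  =
    ⊥-elim (0≢1+n (≡-sym (star-centre x~z z~y x≢y)))

#isEmpty : ∀ n → count {n} (λ S → T? (isEmptyᵇ S)) ≡ 1
#isEmpty zero    = refl
#isEmpty (suc n) =
  ≡-trans (count-∷ {n} λ S → T? (isEmptyᵇ S)) (cong₂ _+_ (count-none {n} (λ _ → T? false) λ _ ()) (#isEmpty n))

#atMostOne : ∀ n → count {n} (λ S → T? (atMostOneᵇ S)) ≡ suc n
#atMostOne zero    = refl
#atMostOne (suc n) =
  ≡-trans (count-∷ {n} λ S → T? (atMostOneᵇ S)) (cong₂ _+_ (#isEmpty n) (#atMostOne n))

noc-star : ∀ n → 1 ≤ n → noc (starGraph n) ≡ 2 ^ (n ∸ 1) + n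
noc-star (suc n) _ = begin
  noc (starGraph (suc n))
    ≡⟨ count-∷ (P3-convex? (starGraph (suc n))) ⟩
  count (λ S → P3-convex? (starGraph (suc n)) (true ∷ S))
    + count (λ S → P3-convex? (starGraph (suc n)) (false ∷ S))
    ≡⟨ cong₂ _+_ (count-all {n} _ λ S → star-convex-∋centre (true ∷ S) _)
                 (count-⇔ _ (λ S → T? (atMostOneᵇ S)) convex⇔atMostOneᵇ) ⟩
  2 ^ n + count {n} (λ S → T? (atMostOneᵇ S))
    ≡⟨ cong (2 ^ n +_) (#atMostOne n) ⟩
  2 ^ n + suc n
    ∎
  where
  open ≡-Reasoning
  convex⇔atMostOneᵇ : ∀ S → P3-convex (starGraph (suc n)) (false ∷ S) ⇔ T (atMostOneᵇ S)
  convex⇔atMostOneᵇ S = ⇔-sym (T-atMostOneᵇ S) ⇔-∘ star-convex⇔atMostOne S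

proposition2p9 : (n : ℕ) → 1 ≤ n →
    (noc (pathGraph n) ≤ noc (starGraph n))
    × (noc (starGraph n) ≡ 2 ^ (n ∸ 1) + n)
    × ((noc (pathGraph n) ≡ noc (starGraph n)) ⇔ (n ≤ 5))
proposition2p9 n 1≤n rewrite noc-path n | noc-star n 1≤n with n ≤? 5
... | yes n≤5 = ≤-reflexive equal , refl , mk⇔ (const n≤5) (const equal)
  where
  equal : #gapFree n ≡ 2 ^ (n ∸ 1) + n
  equal = #gapFree-small n 1≤n n≤5
... | no  n≰5 =
  <⇒≤ smaller , refl , mk⇔ (λ equal → contradiction equal (<⇒≢ smaller)) (λ n≤5 → contradiction n≤5 n≰5)
  where
  smaller : #gapFree n < 2 ^ (n ∸ 1) + n
  smaller = #gapFree-large n (≰⇒> n≰5)
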